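{- Let $t, r$ be integers with $1 \leq t \leq r$, let $\mathcal{H}$ be a hereditary family with $\mu(\mathcal{H}) \geq 2r$, let $\emptyset \neq S \subseteq [t,r]$, let $\mathcal{F} := \bigcup_{s \in S}\mathcal{H}^{(s)}$, and let $\mathcal{L}$ be a largest $t$-star of $\mathcal{F}$. Then \[|\mathcal{F}| > \frac{\binom{\mu(\mathcal{H}) - r}{t}}{\binom{r}{t}} |\mathcal{L}|.\]
   Context: All sets and families are finite. For integers $m \le n$, $[m,n] := \{i \in \{1,2,\dots\} : m \le i \le n\}$. A family $\mathcal{H}$ is hereditary if every subset of every member of $\mathcal{H}$ is a member of $\mathcal{H}$. A base of a family $\mathcal{F}$ is a set $B \in \mathcal{F}$ that is not a proper subset of any member of $\mathcal{F}$; $\mu(\mathcal{F})$ denotes the size of a smallest base of $\mathcal{F}$. $\mathcal{H}^{(s)} := \{H \in \mathcal{H} : |H| = s\}$. For a family $\mathcal{F}$ and a set $T$, $\mathcal{F}\langle T\rangle := \{F \in \mathcal{F} : T \subseteq F\}$; this is a $t$-star of $\mathcal{F}$ if $|T| = t$, and a largest $t$-star is one of maximum size among all $t$-stars of $\mathcal{F}$. -}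

module Defs where

open import Data.Nat using (ℕ; _≤_)
open import Data.Nat.Properties using (_≟_)
open import Data.Fin.Subset using (Subset; _⊆_; _⊂_; ∣_∣)
open import Data.Fin.Subset.Properties using (_⊆?_)
open import Data.List using (List; filter; length)
import Data.List.Membership.Propositional as LM
open import Data.List.Membership.DecPropositional _≟_ using (_∈?_)
open import Data.Product using (Σ; _×_)
open import Relation.Binary.PropositionalEquality using (_≡_)
open import Relation.Nullary using (¬_)

-- A (finite) family of finite subsets of the ground set Fin n is a list of
-- subsets; it is required to be duplicate-free (Unique) where it is used.
Family : ℕ → Set
Family n = List (Subset n)

_∈F_ : ∀ {n} → Subset n → Family n → Set
A ∈F H = A LM.∈ H

Hereditary : ∀ {n} → Family n → Set
Hereditary H = ∀ {A B} → A ∈F H → B ⊆ A → B ∈F H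

IsBase : ∀ {n} → Family n → Subset n → Set
IsBase F B = B ∈F F × (∀ {A} → A ∈F F → ¬ (B ⊂ A))

IsMu : ∀ {n} → Family n → ℕ → Set
IsMu F m = Σ _ (λ B → IsBase F B × ∣ B ∣ ≡ m) × (∀ B → IsBase F B → m ≤ ∣ B ∣)

layers : ∀ {n} → Family n → List ℕ → Family n
layers H S = filter (λ A → ∣ A ∣ ∈? S) H

star : ∀ {n} → Family n → Subset n → Family n
star F T = filter (λ A → T ⊆? A) F

IsLargestStar : ∀ {n} → Family n → ℕ → Subset n → Set
IsLargestStar F t T =
  ∣ T ∣ ≡ t × (∀ T' → ∣ T' ∣ ≡ t → length (star F T') ≤ length (star F T))

module Submission where

-- Proof by double counting.  Let F = ⋃_{s∈S} H^(s), let L = F⟨T⟩ be the given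
-- largest t-star and F₀ = F ∖ L the members of F not containing T.  Extend each
-- A ∈ L to a base B(A) of H; as ∣B(A)∣ ≥ μ(H) and ∣A∣ ≤ r, the set B(A) ─ A has
-- at least μ(H) − r points.  For every t-subset X of B(A) ─ A the exchanged set
-- G = (A ─ T) ∪ X lies below B(A), hence in H, has the size of A and misses a
-- point of T, so G ∈ F₀ and X ⊆ G; moreover A = (G ─ X) ∪ T is recovered from
-- the pair (G , X).  So the pairs (G , X) with G ∈ F₀, X ⊆ G, ∣X∣ = t, of which
-- there are at most ∣F₀∣·C(r,t), contain C(μ(H)−r, t) distinct pairs per A ∈ L:
--        ∣L∣ · C(μ(H) − r, t)  ≤  ∣F₀∣ · C(r, t).
-- Since ∣F∣ = ∣L∣ + ∣F₀∣ and a largest star of the nonempty family F is nonempty,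
-- the strict inequality follows.

open import Defs
open import Data.Nat using (ℕ; zero; suc; _≤_; _<_; _+_; _*_; _∸_; z≤n; s≤s)
open import Data.Nat.Properties
open import Data.Nat.Combinatorics using (_C_; nCn≡1; nCk+nC[k+1]≡[n+1]C[k+1])
open import Data.Vec.Base using ([]; _∷_; here; there)
open import Data.Vec.Properties using (∷-injectiveʳ)
open import Data.Fin.Subset
  using (Subset; inside; outside; _∈_; _⊆_; _─_; _∪_; ∣_∣; Nonempty)
open import Data.Fin.Subset.Properties
  using (_⊆?_; _⊂?_; ⊆-refl; ⊆-trans; drop-∷-⊆; out⊆; in⊆in; p⊂q⇒p⊆q; p⊂q⇒∣p∣<∣q∣;
         ∣p∣≤n; p─q⊆p; q⊆p∪q; x∈p∪q⁻; nonempty?; Empty-unique; ∣⊥∣≡0)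
open import Data.List using (List; []; _∷_; [_]; _++_; length; map; filter; concatMap)
open import Data.List.Properties using (length-map; length-++; length-removeAt′)
open import Data.List.Relation.Unary.All using (All; _∷_)
open import Data.List.Relation.Unary.AllPairs using ([]; _∷_)
import Data.List.Relation.Unary.All as All
open import Data.List.Relation.Unary.Any using (here; there; any?; index)
open import Data.List.Relation.Unary.Unique.Propositional using (Unique)
open import Data.List.Relation.Unary.Unique.Propositional.Properties using (map⁺; ++⁺; filter⁺)
open import Data.List.Membership.Propositional
  using (find; lose) renaming (_∈_ to _∈ₗ_; _─_ to _∖ₗ_)
open import Data.List.Membership.Propositional.Properties
  using (∈-map⁺; ∈-map⁻; ∈-++⁺ˡ; ∈-++⁺ʳ; ∈-++⁻; ∈-filter⁺; ∈-filter⁻; ∈-concatMap⁺; ∈-concatMap⁻)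
open import Data.Product using (Σ; _×_; _,_; proj₁; proj₂)
open import Data.Sum using (inj₁; inj₂; [_,_]′)
open import Data.Empty using (⊥; ⊥-elim)
open import Function using (_∘_)
open import Relation.Nullary using (¬_; yes; no)
open import Relation.Unary using (Pred; Decidable)
open import Relation.Unary.Properties using (∁?)
open import Relation.Binary.PropositionalEquality
  using (_≡_; _≢_; refl; sym; trans; cong; cong₂; subst; module ≡-Reasoning)
open import Data.List.Membership.DecPropositional _≟_ using (_∈?_)

Disjoint : ∀ {n} → Subset n → Subset n → Set
Disjoint p q = ∀ {i} → i ∈ p → i ∈ q → ⊥

Disjoint-tail : ∀ {n x y} {p q : Subset n} → Disjoint (x ∷ p) (y ∷ q) → Disjoint p q
Disjoint-tail p#q i∈p i∈q = p#q (there i∈p) (there i∈q)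

p─q#q : ∀ {n} (p q : Subset n) → Disjoint (p ─ q) q
p─q#q (inside ∷ p) (outside ∷ q) here        ()
p─q#q (_      ∷ p) (_       ∷ q) (there i∈) (there i∈q) = p─q#q p q i∈ i∈q

∣p─q∣+∣q∣≡∣p∣ : ∀ {n} (p q : Subset n) → q ⊆ p → ∣ p ─ q ∣ + ∣ q ∣ ≡ ∣ p ∣
∣p─q∣+∣q∣≡∣p∣ []            []            _   = refl
∣p─q∣+∣q∣≡∣p∣ (outside ∷ p) (outside ∷ q) q⊆p = ∣p─q∣+∣q∣≡∣p∣ p q (drop-∷-⊆ q⊆p)
∣p─q∣+∣q∣≡∣p∣ (inside  ∷ p) (outside ∷ q) q⊆p = cong suc (∣p─q∣+∣q∣≡∣p∣ p q (drop-∷-⊆ q⊆p))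
∣p─q∣+∣q∣≡∣p∣ (inside  ∷ p) (inside  ∷ q) q⊆p =
  trans (+-suc ∣ p ─ q ∣ ∣ q ∣) (cong suc (∣p─q∣+∣q∣≡∣p∣ p q (drop-∷-⊆ q⊆p)))
∣p─q∣+∣q∣≡∣p∣ (outside ∷ p) (inside  ∷ q) q⊆p with () ← q⊆p here

∣p∪q∣≡∣p∣+∣q∣ : ∀ {n} (p q : Subset n) → Disjoint p q → ∣ p ∪ q ∣ ≡ ∣ p ∣ + ∣ q ∣
∣p∪q∣≡∣p∣+∣q∣ []            []            _   = refl
∣p∪q∣≡∣p∣+∣q∣ (outside ∷ p) (outside ∷ q) p#q = ∣p∪q∣≡∣p∣+∣q∣ p q (Disjoint-tail p#q)
∣p∪q∣≡∣p∣+∣q∣ (inside  ∷ p) (outside ∷ q) p#q = cong suc (∣p∪q∣≡∣p∣+∣q∣ p q (Disjoint-tail p#q))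
∣p∪q∣≡∣p∣+∣q∣ (outside ∷ p) (inside  ∷ q) p#q =
  trans (cong suc (∣p∪q∣≡∣p∣+∣q∣ p q (Disjoint-tail p#q))) (sym (+-suc ∣ p ∣ ∣ q ∣))
∣p∪q∣≡∣p∣+∣q∣ (inside  ∷ p) (inside  ∷ q) p#q = ⊥-elim (p#q here here)

exchange-inverse : ∀ {n} (A T X : Subset n) → T ⊆ A → Disjoint X A →
                   (((A ─ T) ∪ X) ─ X) ∪ T ≡ A
exchange-inverse [] [] [] _ _ = refl
exchange-inverse (outside ∷ A) (outside ∷ T) (outside ∷ X) T⊆A X#A =
  cong (outside ∷_) (exchange-inverse A T X (drop-∷-⊆ T⊆A) (Disjoint-tail X#A))
exchange-inverse (inside  ∷ A) (outside ∷ T) (outside ∷ X) T⊆A X#A =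
  cong (inside ∷_) (exchange-inverse A T X (drop-∷-⊆ T⊆A) (Disjoint-tail X#A))
exchange-inverse (inside  ∷ A) (inside  ∷ T) (outside ∷ X) T⊆A X#A =
  cong (inside ∷_) (exchange-inverse A T X (drop-∷-⊆ T⊆A) (Disjoint-tail X#A))
exchange-inverse (outside ∷ A) (outside ∷ T) (inside  ∷ X) T⊆A X#A =
  cong (outside ∷_) (exchange-inverse A T X (drop-∷-⊆ T⊆A) (Disjoint-tail X#A))
exchange-inverse (outside ∷ A) (inside  ∷ T) X            T⊆A X#A with () ← T⊆A here
exchange-inverse (inside  ∷ A) T            (inside  ∷ X) T⊆A X#A = ⊥-elim (X#A here here)

size-pos⇒nonempty : ∀ {n} (p : Subset n) → 1 ≤ ∣ p ∣ → Nonempty p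
size-pos⇒nonempty {n} p 1≤∣p∣ with nonempty? p
... | yes p≢∅ = p≢∅
... | no  p≡∅ with () ← subst (1 ≤_) (trans (cong ∣_∣ (Empty-unique p≡∅)) (∣⊥∣≡0 n)) 1≤∣p∣

C-mono-suc : ∀ a k → a C k ≤ suc a C k
C-mono-suc a zero    = ≤-refl
C-mono-suc a (suc k) = subst (a C suc k ≤_) (nCk+nC[k+1]≡[n+1]C[k+1] a k) (m≤n+m _ _)

C-mono : ∀ k {a b} → a ≤ b → a C k ≤ b C k
C-mono k {b = zero}  z≤n = ≤-refl
C-mono k {b = suc b} a≤1+b with m≤n⇒m<n∨m≡n a≤1+b
... | inj₂ refl      = ≤-refl
... | inj₁ (s≤s a≤b) = ≤-trans (C-mono k a≤b) (C-mono-suc b k)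

C-pos : ∀ {n k} → k ≤ n → 1 ≤ n C k
C-pos {n} {k} k≤n = subst (_≤ n C k) (nCn≡1 k) (C-mono k k≤n)

subsetsOfSize : ∀ {n} → ℕ → Subset n → List (Subset n)
subsetsOfSize k       (outside ∷ U) = map (outside ∷_) (subsetsOfSize k U)
subsetsOfSize zero    []            = [ [] ]
subsetsOfSize (suc k) []            = []
subsetsOfSize zero    (inside ∷ U)  = map (outside ∷_) (subsetsOfSize zero U)
subsetsOfSize (suc k) (inside ∷ U)  =
  map (outside ∷_) (subsetsOfSize (suc k) U) ++ map (inside ∷_) (subsetsOfSize k U)

length-subsetsOfSize : ∀ {n} k (U : Subset n) → length (subsetsOfSize k U) ≡ ∣ U ∣ C k
length-subsetsOfSize k       (outside ∷ U) =
  trans (length-map (outside ∷_) (subsetsOfSize k U)) (length-subsetsOfSize k U)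
length-subsetsOfSize zero    []            = refl
length-subsetsOfSize (suc k) []            = refl
length-subsetsOfSize zero    (inside ∷ U)  =
  trans (length-map (outside ∷_) (subsetsOfSize zero U)) (length-subsetsOfSize zero U)
length-subsetsOfSize (suc k) (inside ∷ U)  = begin
  length (map (outside ∷_) (subsetsOfSize (suc k) U) ++ map (inside ∷_) (subsetsOfSize k U))
    ≡⟨ length-++ (map (outside ∷_) (subsetsOfSize (suc k) U)) ⟩
  length (map (outside ∷_) (subsetsOfSize (suc k) U)) + length (map (inside ∷_) (subsetsOfSize k U))
    ≡⟨ cong₂ _+_
         (trans (length-map (outside ∷_) (subsetsOfSize (suc k) U)) (length-subsetsOfSize (suc k) U))
         (trans (length-map (inside ∷_) (subsetsOfSize k U)) (length-subsetsOfSize k U)) ⟩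
  ∣ U ∣ C suc k + ∣ U ∣ C k
    ≡⟨ +-comm (∣ U ∣ C suc k) (∣ U ∣ C k) ⟩
  ∣ U ∣ C k + ∣ U ∣ C suc k
    ≡⟨ nCk+nC[k+1]≡[n+1]C[k+1] ∣ U ∣ k ⟩
  suc ∣ U ∣ C suc k ∎
  where open ≡-Reasoning

subsetsOfSize-unique : ∀ {n} k (U : Subset n) → Unique (subsetsOfSize k U)
subsetsOfSize-unique k       (outside ∷ U) = map⁺ ∷-injectiveʳ (subsetsOfSize-unique k U)
subsetsOfSize-unique zero    []            = All.[] ∷ []
subsetsOfSize-unique (suc k) []            = []
subsetsOfSize-unique zero    (inside ∷ U)  = map⁺ ∷-injectiveʳ (subsetsOfSize-unique zero U)
subsetsOfSize-unique (suc k) (inside ∷ U)  =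
  ++⁺ (map⁺ ∷-injectiveʳ (subsetsOfSize-unique (suc k) U))
      (map⁺ ∷-injectiveʳ (subsetsOfSize-unique k U))
      heads-differ
  where
  heads-differ : ∀ {X} → ¬ (X ∈ₗ map (outside ∷_) (subsetsOfSize (suc k) U)
                           × X ∈ₗ map (inside ∷_) (subsetsOfSize k U))
  heads-differ (X∈out , X∈in) with ∈-map⁻ (outside ∷_) X∈out | ∈-map⁻ (inside ∷_) X∈in
  ... | _ , _ , refl | _ , _ , ()

subsetsOfSize⁻ : ∀ {n} k (U : Subset n) {X} → X ∈ₗ subsetsOfSize k U → X ⊆ U × ∣ X ∣ ≡ k
subsetsOfSize⁻ k (outside ∷ U) X∈ with ∈-map⁻ (outside ∷_) X∈
... | Y , Y∈ , refl with subsetsOfSize⁻ k U Y∈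
...   | Y⊆U , ∣Y∣≡k = out⊆ Y⊆U , ∣Y∣≡k
subsetsOfSize⁻ zero [] (here refl) = (λ ()) , refl
subsetsOfSize⁻ zero (inside ∷ U) X∈ with ∈-map⁻ (outside ∷_) X∈
... | Y , Y∈ , refl with subsetsOfSize⁻ zero U Y∈
...   | Y⊆U , ∣Y∣≡0 = out⊆ Y⊆U , ∣Y∣≡0
subsetsOfSize⁻ (suc k) (inside ∷ U) X∈ with ∈-++⁻ (map (outside ∷_) (subsetsOfSize (suc k) U)) X∈
... | inj₁ X∈out with ∈-map⁻ (outside ∷_) X∈out
...   | Y , Y∈ , refl with subsetsOfSize⁻ (suc k) U Y∈
...     | Y⊆U , ∣Y∣≡k = out⊆ Y⊆U , ∣Y∣≡k
subsetsOfSize⁻ (suc k) (inside ∷ U) X∈ | inj₂ X∈in with ∈-map⁻ (inside ∷_) X∈in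
...   | Y , Y∈ , refl with subsetsOfSize⁻ k U Y∈
...     | Y⊆U , ∣Y∣≡k = in⊆in Y⊆U , cong suc ∣Y∣≡k

subsetsOfSize⁺ : ∀ {n} k (U X : Subset n) → X ⊆ U → ∣ X ∣ ≡ k → X ∈ₗ subsetsOfSize k U
subsetsOfSize⁺ zero    []            []            _   refl = here refl
subsetsOfSize⁺ k       (outside ∷ U) (outside ∷ X) X⊆U ∣X∣≡k =
  ∈-map⁺ (outside ∷_) (subsetsOfSize⁺ k U X (drop-∷-⊆ X⊆U) ∣X∣≡k)
subsetsOfSize⁺ k       (outside ∷ U) (inside  ∷ X) X⊆U _ with () ← X⊆U here
subsetsOfSize⁺ zero    (inside  ∷ U) (outside ∷ X) X⊆U ∣X∣≡0 =
  ∈-map⁺ (outside ∷_) (subsetsOfSize⁺ zero U X (drop-∷-⊆ X⊆U) ∣X∣≡0)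
subsetsOfSize⁺ (suc k) (inside  ∷ U) (outside ∷ X) X⊆U ∣X∣≡k =
  ∈-++⁺ˡ (∈-map⁺ (outside ∷_) (subsetsOfSize⁺ (suc k) U X (drop-∷-⊆ X⊆U) ∣X∣≡k))
subsetsOfSize⁺ (suc k) (inside  ∷ U) (inside  ∷ X) X⊆U refl =
  ∈-++⁺ʳ (map (outside ∷_) (subsetsOfSize (suc k) U))
         (∈-map⁺ (inside ∷_) (subsetsOfSize⁺ k U X (drop-∷-⊆ X⊆U) refl))

module _ {a} {A : Set a} where

  ∈⇒length-pos : ∀ {x : A} {xs} → x ∈ₗ xs → 1 ≤ length xs
  ∈⇒length-pos (here _)  = s≤s z≤n
  ∈⇒length-pos (there _) = s≤s z≤n

  element-of : (xs : List A) → 1 ≤ length xs → Σ A (_∈ₗ xs)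
  element-of (x ∷ _) _ = x , here refl

  element-with : ∀ {p} {P : A → Set p} (xs : List A) → xs ≢ [] → All P xs →
                 Σ A λ x → x ∈ₗ xs × P x
  element-with []      xs≢[] _        = ⊥-elim (xs≢[] refl)
  element-with (x ∷ _) _     (px ∷ _) = x , here refl , px

  length-filter-split : ∀ {p} {P : Pred A p} (P? : Decidable P) xs →
    length (filter P? xs) + length (filter (∁? P?) xs) ≡ length xs
  length-filter-split P? []       = refl
  length-filter-split P? (x ∷ xs) with P? x
  ... | yes _ = cong suc (length-filter-split P? xs)
  ... | no  _ = trans (+-suc _ _) (cong suc (length-filter-split P? xs))

  ∈-─ : ∀ {x z : A} {ys} (x∈ys : x ∈ₗ ys) → z ∈ₗ ys → z ≢ x → z ∈ₗ ys ∖ₗ x∈ys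
  ∈-─ (here refl)  (here refl)  z≢x = ⊥-elim (z≢x refl)
  ∈-─ (here refl)  (there z∈ys) _   = z∈ys
  ∈-─ (there _)    (here refl)  _   = here refl
  ∈-─ (there x∈ys) (there z∈ys) z≢x = there (∈-─ x∈ys z∈ys z≢x)

  unique-⊆⇒length-≤ : ∀ {xs ys : List A} → Unique xs → (∀ {x} → x ∈ₗ xs → x ∈ₗ ys) →
                      length xs ≤ length ys
  unique-⊆⇒length-≤ {[]}     _                  _     = z≤n
  unique-⊆⇒length-≤ {x ∷ xs} {ys} (x≢xs ∷ xs!) xs⊆ys = begin
    suc (length xs)          ≤⟨ s≤s (unique-⊆⇒length-≤ xs! rest⊆) ⟩
    suc (length (ys ∖ₗ x∈ys)) ≡⟨ length-removeAt′ ys (index x∈ys) ⟨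
    length ys                ∎
    where
    open ≤-Reasoning
    x∈ys : x ∈ₗ ys
    x∈ys = xs⊆ys (here refl)
    rest⊆ : ∀ {z} → z ∈ₗ xs → z ∈ₗ ys ∖ₗ x∈ys
    rest⊆ z∈xs = ∈-─ x∈ys (xs⊆ys (there z∈xs)) (All.lookup x≢xs z∈xs ∘ sym)

module _ {a b} {A : Set a} {B : Set b} where

  ∈-concatMap-block : (f : A → List B) {xs : List A} {y : B} → y ∈ₗ concatMap f xs →
                      Σ A λ x → x ∈ₗ xs × y ∈ₗ f x
  ∈-concatMap-block f y∈ = find (∈-concatMap⁻ f y∈)

  concatMap-unique : (f : A → List B) (owner : B → A) {xs : List A} → Unique xs →
    (∀ {x} → x ∈ₗ xs → Unique (f x)) → (∀ {x y} → x ∈ₗ xs → y ∈ₗ f x → owner y ≡ x) →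
    Unique (concatMap f xs)
  concatMap-unique f owner {[]}     _            _  _   = []
  concatMap-unique f owner {x ∷ xs} (x≢xs ∷ xs!) f! own =
    ++⁺ (f! (here refl))
        (concatMap-unique f owner xs! (λ x∈ → f! (there x∈)) (λ x∈ → own (there x∈)))
        blocks-disjoint
    where
    blocks-disjoint : ∀ {y} → ¬ (y ∈ₗ f x × y ∈ₗ concatMap f xs)
    blocks-disjoint (y∈fx , y∈rest) with ∈-concatMap-block f y∈rest
    ... | x′ , x′∈xs , y∈fx′ =
      All.lookup x≢xs x′∈xs (trans (sym (own (here refl) y∈fx)) (own (there x′∈xs) y∈fx′))

  length-concatMap-≥ : (f : A → List B) (xs : List A) (c : ℕ) →
    (∀ {x} → x ∈ₗ xs → c ≤ length (f x)) → length xs * c ≤ length (concatMap f xs)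
  length-concatMap-≥ f []       c big = z≤n
  length-concatMap-≥ f (x ∷ xs) c big = subst (c + length xs * c ≤_) (sym (length-++ (f x)))
    (+-mono-≤ (big (here refl)) (length-concatMap-≥ f xs c (λ x∈ → big (there x∈))))

  length-concatMap-≤ : (f : A → List B) (xs : List A) (c : ℕ) →
    (∀ {x} → x ∈ₗ xs → length (f x) ≤ c) → length (concatMap f xs) ≤ length xs * c
  length-concatMap-≤ f []       c small = z≤n
  length-concatMap-≤ f (x ∷ xs) c small = subst (_≤ c + length xs * c) (sym (length-++ (f x)))
    (+-mono-≤ (small (here refl)) (length-concatMap-≤ f xs c (λ x∈ → small (there x∈))))

  double-counting : (w : A → List B) (owner : B → A) (xs : List A) (ys : List B) (c : ℕ) →
    Unique xs →
    (∀ {x} → x ∈ₗ xs → Unique (w x) × c ≤ length (w x)) →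
    (∀ {x y} → x ∈ₗ xs → y ∈ₗ w x → y ∈ₗ ys × owner y ≡ x) →
    length xs * c ≤ length ys
  double-counting w owner xs ys c xs! many witness = begin
    length xs * c           ≤⟨ length-concatMap-≥ w xs c (λ x∈ → proj₂ (many x∈)) ⟩
    length (concatMap w xs) ≤⟨ unique-⊆⇒length-≤ all-distinct all-in-ys ⟩
    length ys               ∎
    where
    open ≤-Reasoning
    all-distinct : Unique (concatMap w xs)
    all-distinct = concatMap-unique w owner xs! (λ x∈ → proj₁ (many x∈))
                                    (λ x∈ y∈ → proj₂ (witness x∈ y∈))
    all-in-ys : ∀ {y} → y ∈ₗ concatMap w xs → y ∈ₗ ys
    all-in-ys y∈ with ∈-concatMap-block w y∈
    ... | x , x∈ , y∈wx = proj₁ (witness x∈ y∈wx)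

subset-of-size : ∀ {n} k (U : Subset n) → k ≤ ∣ U ∣ → Σ (Subset n) λ X → X ⊆ U × ∣ X ∣ ≡ k
subset-of-size k U k≤∣U∣ with element-of (subsetsOfSize k U)
                                (subst (1 ≤_) (sym (length-subsetsOfSize k U)) (C-pos k≤∣U∣))
... | X , X∈ = X , subsetsOfSize⁻ k U X∈

module _ {n} (H : Family n) where

  grow : ℕ → Subset n → Subset n
  grow zero        A = A
  grow (suc fuel) A with any? (A ⊂?_) H
  ... | yes A⊂some = grow fuel (proj₁ (find A⊂some))
  ... | no  _      = A

  grow-base : ∀ fuel A → n ≤ fuel + ∣ A ∣ → A ∈F H → IsBase H (grow fuel A) × A ⊆ grow fuel A
  grow-base zero A n≤∣A∣ A∈H =
    (A∈H , λ {C} _ A⊂C → <⇒≱ (p⊂q⇒∣p∣<∣q∣ A⊂C) (≤-trans (∣p∣≤n C) n≤∣A∣)) , ⊆-refl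
  grow-base (suc fuel) A n≤ A∈H with any? (A ⊂?_) H
  ... | no  A-maximal = (A∈H , λ C∈H A⊂C → A-maximal (lose C∈H A⊂C)) , ⊆-refl
  ... | yes A⊂some with find A⊂some
  ...   | D , D∈H , A⊂D with grow-base fuel D n≤′ D∈H
    where
    n≤′ : n ≤ fuel + ∣ D ∣
    n≤′ = ≤-trans n≤ (subst (_≤ fuel + ∣ D ∣) (+-suc fuel ∣ A ∣) (+-monoʳ-≤ fuel (p⊂q⇒∣p∣<∣q∣ A⊂D)))
  ...     | B-base , D⊆B = B-base , ⊆-trans (p⊂q⇒p⊆q A⊂D) D⊆B

  baseAbove : Subset n → Subset n
  baseAbove = grow n

  baseAbove-spec : ∀ {A} → A ∈F H → IsBase H (baseAbove A) × A ⊆ baseAbove A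
  baseAbove-spec {A} = grow-base n A (m≤m+n n ∣ A ∣)

layers-member : ∀ {n} (H : Family n) (S : List ℕ) {B s} → Hereditary H → IsBase H B →
  s ≤ ∣ B ∣ → s ∈ₗ S → Σ (Subset n) λ G → G ∈F layers H S × ∣ G ∣ ≡ s
layers-member H S {B} {s} hereditary (B∈H , _) s≤∣B∣ s∈S with subset-of-size s B s≤∣B∣
... | G , G⊆B , ∣G∣≡s =
  G , ∈-filter⁺ (λ A → ∣ A ∣ ∈? S) (hereditary B∈H G⊆B) (subst (_∈ₗ S) (sym ∣G∣≡s) s∈S) , ∣G∣≡s

largestStar-nonempty : ∀ {n} (F : Family n) t T {G} → G ∈F F → t ≤ ∣ G ∣ →
  IsLargestStar F t T → 1 ≤ length (star F T)
largestStar-nonempty F t T {G} G∈F t≤∣G∣ (_ , largest) with subset-of-size t G t≤∣G∣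
... | T′ , T′⊆G , ∣T′∣≡t =
  ≤-trans (∈⇒length-pos (∈-filter⁺ (T′ ⊆?_) G∈F T′⊆G)) (largest T′ ∣T′∣≡t)

module Exchange {n} (H : Family n) (hereditary : Hereditary H) (S : List ℕ) (T : Subset n)
                (t r m : ℕ) (1≤t : 1 ≤ t) (∣T∣≡t : ∣ T ∣ ≡ t)
                (sizes≤r : All (_≤ r) S) (bases≥m : ∀ B → IsBase H B → m ≤ ∣ B ∣) where

  F : Family n
  F = layers H S

  L : Family n
  L = star F T

  F₀ : Family n
  F₀ = filter (∁? (T ⊆?_)) F

  F⊆H : ∀ {G} → G ∈F F → G ∈F H
  F⊆H = proj₁ ∘ ∈-filter⁻ (λ A → ∣ A ∣ ∈? S) {xs = H}

  ∣F∣∈S : ∀ {G} → G ∈F F → ∣ G ∣ ∈ₗ S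
  ∣F∣∈S = proj₂ ∘ ∈-filter⁻ (λ A → ∣ A ∣ ∈? S) {xs = H}

  ∣F∣≤r : ∀ {G} → G ∈F F → ∣ G ∣ ≤ r
  ∣F∣≤r G∈F = All.lookup sizes≤r (∣F∣∈S G∈F)

  L⊆F : ∀ {A} → A ∈F L → A ∈F F
  L⊆F = proj₁ ∘ ∈-filter⁻ (T ⊆?_) {xs = F}

  F₀⊆F : ∀ {G} → G ∈F F₀ → G ∈F F
  F₀⊆F = proj₁ ∘ ∈-filter⁻ (∁? (T ⊆?_)) {xs = F}

  T⊆L : ∀ {A} → A ∈F L → T ⊆ A
  T⊆L = proj₂ ∘ ∈-filter⁻ (T ⊆?_) {xs = F}

  exchangeSets : Subset n → List (Subset n)
  exchangeSets A = subsetsOfSize t (baseAbove H A ─ A)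

  exchange : Subset n → Subset n → Subset n × Subset n
  exchange A X = (A ─ T) ∪ X , X

  owner : Subset n × Subset n → Subset n
  owner (G , X) = (G ─ X) ∪ T

  pairs : List (Subset n × Subset n)
  pairs = concatMap (λ G → map (G ,_) (subsetsOfSize t G)) F₀

  exchange-valid : ∀ {A X} → A ∈F L → X ∈ₗ exchangeSets A →
                   exchange A X ∈ₗ pairs × owner (exchange A X) ≡ A
  exchange-valid {A} {X} A∈L X∈ =
    ∈-concatMap⁺ (λ G → map (G ,_) (subsetsOfSize t G)) (lose G∈F₀ X-pair) ,
    exchange-inverse A T X (T⊆L A∈L) X#A
    where
    B : Subset n
    B = baseAbove H A
    B-spec : IsBase H B × A ⊆ B
    B-spec = baseAbove-spec H (F⊆H (L⊆F A∈L))
    X⊆B─A : X ⊆ B ─ A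
    X⊆B─A = proj₁ (subsetsOfSize⁻ t (B ─ A) X∈)
    ∣X∣≡t : ∣ X ∣ ≡ t
    ∣X∣≡t = proj₂ (subsetsOfSize⁻ t (B ─ A) X∈)
    X#A : Disjoint X A
    X#A i∈X = p─q#q B A (X⊆B─A i∈X)
    G : Subset n
    G = (A ─ T) ∪ X
    G⊆B : G ⊆ B
    G⊆B i∈G = [ proj₂ B-spec ∘ p─q⊆p A T , p─q⊆p B A ∘ X⊆B─A ]′ (x∈p∪q⁻ (A ─ T) X i∈G)
    ∣G∣≡∣A∣ : ∣ G ∣ ≡ ∣ A ∣
    ∣G∣≡∣A∣ = begin
      ∣ (A ─ T) ∪ X ∣     ≡⟨ ∣p∪q∣≡∣p∣+∣q∣ (A ─ T) X (λ i∈A─T i∈X → X#A i∈X (p─q⊆p A T i∈A─T)) ⟩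
      ∣ A ─ T ∣ + ∣ X ∣   ≡⟨ cong (∣ A ─ T ∣ +_) (trans ∣X∣≡t (sym ∣T∣≡t)) ⟩
      ∣ A ─ T ∣ + ∣ T ∣   ≡⟨ ∣p─q∣+∣q∣≡∣p∣ A T (T⊆L A∈L) ⟩
      ∣ A ∣               ∎
      where open ≡-Reasoning
    -- G does not contain T: a point of T lies neither in A ─ T nor in X ⊆ B ─ A.
    T⊈G : ¬ (T ⊆ G)
    T⊈G T⊆G with size-pos⇒nonempty T (subst (1 ≤_) (sym ∣T∣≡t) 1≤t)
    ... | i , i∈T with x∈p∪q⁻ (A ─ T) X (T⊆G i∈T)
    ...   | inj₁ i∈A─T = p─q#q A T i∈A─T i∈T
    ...   | inj₂ i∈X   = X#A i∈X (T⊆L A∈L i∈T)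
    G∈F₀ : G ∈F F₀
    G∈F₀ = ∈-filter⁺ (∁? (T ⊆?_))
             (∈-filter⁺ (λ A → ∣ A ∣ ∈? S) (hereditary (proj₁ (proj₁ B-spec)) G⊆B)
                        (subst (_∈ₗ S) (sym ∣G∣≡∣A∣) (∣F∣∈S (L⊆F A∈L))))
             T⊈G
    X-pair : (G , X) ∈ₗ map (G ,_) (subsetsOfSize t G)
    X-pair = ∈-map⁺ (G ,_) (subsetsOfSize⁺ t G X (q⊆p∪q (A ─ T) X) ∣X∣≡t)

  -- Every member of L has at least C(m − r, t) exchange sets, as B(A) ─ A
  -- has ∣B(A)∣ − ∣A∣ ≥ m − r points.
  exchangeSets-many : ∀ {A} → A ∈F L → (m ∸ r) C t ≤ length (exchangeSets A)
  exchangeSets-many {A} A∈L = begin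
    (m ∸ r) C t                ≤⟨ C-mono t (∸-mono (bases≥m B (proj₁ B-spec)) (∣F∣≤r (L⊆F A∈L))) ⟩
    (∣ B ∣ ∸ ∣ A ∣) C t        ≡⟨ cong (_C t) ∣B─A∣ ⟨
    ∣ B ─ A ∣ C t              ≡⟨ length-subsetsOfSize t (B ─ A) ⟨
    length (exchangeSets A)    ∎
    where
    open ≤-Reasoning
    B : Subset n
    B = baseAbove H A
    B-spec : IsBase H B × A ⊆ B
    B-spec = baseAbove-spec H (F⊆H (L⊆F A∈L))
    ∣B─A∣ : ∣ B ─ A ∣ ≡ ∣ B ∣ ∸ ∣ A ∣
    ∣B─A∣ = trans (sym (m+n∸n≡m ∣ B ─ A ∣ ∣ A ∣))
                  (cong (_∸ ∣ A ∣) (∣p─q∣+∣q∣≡∣p∣ B A (proj₂ B-spec)))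

  pairs-few : length pairs ≤ length F₀ * (r C t)
  pairs-few = length-concatMap-≤ (λ G → map (G ,_) (subsetsOfSize t G)) F₀ (r C t) λ {G} G∈F₀ →
    begin
      length (map (G ,_) (subsetsOfSize t G)) ≡⟨ length-map (G ,_) (subsetsOfSize t G) ⟩
      length (subsetsOfSize t G)              ≡⟨ length-subsetsOfSize t G ⟩
      ∣ G ∣ C t                               ≤⟨ C-mono t (∣F∣≤r (F₀⊆F G∈F₀)) ⟩
      r C t                                   ∎
    where open ≤-Reasoning

  exchanges : Subset n → List (Subset n × Subset n)
  exchanges A = map (exchange A) (exchangeSets A)

  exchanges-many : ∀ {A} → A ∈F L → Unique (exchanges A) × (m ∸ r) C t ≤ length (exchanges A)
  exchanges-many {A} A∈L =
    map⁺ (cong proj₂) (subsetsOfSize-unique t (baseAbove H A ─ A)) ,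
    subst ((m ∸ r) C t ≤_) (sym (length-map (exchange A) (exchangeSets A))) (exchangeSets-many A∈L)

  exchanges-valid : ∀ {A p} → A ∈F L → p ∈ₗ exchanges A → p ∈ₗ pairs × owner p ≡ A
  exchanges-valid {A} A∈L p∈ with ∈-map⁻ (exchange A) p∈
  ... | X , X∈ , refl = exchange-valid A∈L X∈

  star-count : Unique H → length L * ((m ∸ r) C t) ≤ length F₀ * (r C t)
  star-count H! = ≤-trans
    (double-counting exchanges owner L pairs ((m ∸ r) C t)
       (filter⁺ (T ⊆?_) (filter⁺ (λ A → ∣ A ∣ ∈? S) H!)) exchanges-many exchanges-valid)
    pairs-few

  F-split : length L + length F₀ ≡ length F
  F-split = length-filter-split (T ⊆?_) F

lemma4p4 : (n t r m : ℕ) (H : Family n) (S : List ℕ) (T : Subset n)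
    → 1 ≤ t → t ≤ r
    → Unique H → Hereditary H
    → IsMu H m → 2 * r ≤ m
    → S ≢ [] → All (λ s → t ≤ s × s ≤ r) S
    → IsLargestStar (layers H S) t T
    → ((m ∸ r) C t) * length (star (layers H S) T) < (r C t) * length (layers H S)
lemma4p4 n t r m H S T 1≤t t≤r H! hereditary ((B₀ , B₀-base , ∣B₀∣≡m) , bases≥m) 2r≤m
         S≢[] sizes (∣T∣≡t , largest) = begin-strict
  ((m ∸ r) C t) * length L                    ≡⟨ *-comm ((m ∸ r) C t) (length L) ⟩
  length L * ((m ∸ r) C t)                    ≤⟨ star-count H! ⟩
  length F₀ * (r C t)                         ≡⟨ *-comm (length F₀) (r C t) ⟩
  (r C t) * length F₀                         <⟨ m<n+m ((r C t) * length F₀) L-counts ⟩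
  (r C t) * length L + (r C t) * length F₀    ≡⟨ *-distribˡ-+ (r C t) (length L) (length F₀) ⟨
  (r C t) * (length L + length F₀)            ≡⟨ cong ((r C t) *_) F-split ⟩
  (r C t) * length F                          ∎
  where
  open ≤-Reasoning
  open Exchange H hereditary S T t r m 1≤t ∣T∣≡t (All.map proj₂ sizes) bases≥m
  -- Some size s ∈ S is realised in F, as the base B₀ has m ≥ 2r ≥ s points;
  -- as s ≥ t, the largest star L is nonempty.
  L-nonempty : 1 ≤ length L
  L-nonempty with element-with S S≢[] sizes
  ... | s , s∈S , t≤s , s≤r
      with layers-member H S hereditary B₀-base
             (subst (s ≤_) (sym ∣B₀∣≡m) (≤-trans s≤r (≤-trans (m≤n*m r 2) 2r≤m))) s∈S
  ...   | G , G∈F , ∣G∣≡s =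
    largestStar-nonempty F t T G∈F (subst (t ≤_) (sym ∣G∣≡s) t≤s) (∣T∣≡t , largest)
  L-counts : 0 < (r C t) * length L
  L-counts = *-mono-≤ (C-pos t≤r) L-nonempty
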